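{- Let $S$ be a set, $I$ a set, and $\mathcal{O}$ and $\{\mathcal{O}_i\mid i\in I\}$ operators on $S$. (1) If $\mathcal{O}\triangleleft\mathcal{O}_i$ for every $i\in I$, then $\mathcal{O}\triangleleft\bigvee_{i\in I}\mathcal{O}_i$. (2) If $\mathcal{O}_i\triangleleft\mathcal{O}$ for every $i\in I$, then $\bigvee_{i\in I}\mathcal{O}_i\triangleleft\mathcal{O}$.
   Context: All reasoning is intuitionistic (no law of excluded middle). An operator on $S$ is any map $\mathrm{Pow}(S)\to\mathrm{Pow}(S)$. The join is pointwise: $(\bigvee_{i\in I}\mathcal{O}_i)(W)=\bigcup_{i\in I}\mathcal{O}_i(W)$. For $U,V\subseteq S$, $U\between V$ means there exists $a\in U\cap V$. $\mathcal{O}\triangleleft\mathcal{O}'$ means: for all $U,V\subseteq S$, $\mathcal{O}(U)\between\mathcal{O}'(V)$ implies $U\between\mathcal{O}'(V)$. -}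

module Defs where

open import Level using (0ℓ)
open import Data.Product using (Σ; _×_; ∃; ∃-syntax)
open import Relation.Unary using (Pred; _∩_)

Subset : Set → Set₁
Subset S = Pred S 0ℓ

Operator : Set → Set₁
Operator S = Subset S → Subset S

_≬_ : {S : Set} → Subset S → Subset S → Set
_≬_ {S} U V = Σ S λ a → (U ∩ V) a

⋁ : {S I : Set} → (I → Operator S) → Operator S
⋁ {S} {I} O W a = Σ I λ i → O i W a

_◁_ : {S : Set} → Operator S → Operator S → Set₁
_◁_ {S} O O′ = (U V : Subset S) → O U ≬ O′ V → U ≬ O′ V

module Submission where

open import Defs
open import Data.Product using (_×_; _,_)

module _ {S I : Set} where

  ◁-⋁ʳ : {O : Operator S} {Os : I → Operator S}
    → ((i : I) → O ◁ Os i) → O ◁ ⋁ Os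
  ◁-⋁ʳ O◁Os U V (a , Oa , i , Osᵢa) with O◁Os i U V (a , Oa , Osᵢa)
  ... | b , Ub , Osᵢb = b , Ub , i , Osᵢb

  ⋁-◁ˡ : {O : Operator S} {Os : I → Operator S}
    → ((i : I) → Os i ◁ O) → ⋁ Os ◁ O
  ⋁-◁ˡ Os◁O U V (a , (i , Osᵢa) , Oa) = Os◁O i U V (a , Osᵢa , Oa)

lemma1p2 : (S I : Set) (O : Operator S) (Os : I → Operator S)
    → (((i : I) → O ◁ Os i) → O ◁ ⋁ Os)
    × (((i : I) → Os i ◁ O) → ⋁ Os ◁ O)
lemma1p2 S I O Os = ◁-⋁ʳ , ⋁-◁ˡ
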